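{- Let $G_1,G_2$ be finite simple undirected graphs. Then the tensor (direct) product $G_1\times G_2$ is anticonnected.
   Context: The tensor product $G_1\times G_2$ has vertex set $V(G_1)\times V(G_2)$, and $(g,h)$, $(g',h')$ are adjacent iff $g,g'$ are adjacent in $G_1$ and $h,h'$ are adjacent in $G_2$. A graph is anticonnected if its complement is connected. -}

module Defs where

open import Data.Product using (_×_; _,_)
open import Relation.Nullary using (¬_)
open import Relation.Binary.PropositionalEquality using (_≡_; _≢_; sym)
open import Relation.Binary.Construct.Closure.ReflexiveTransitive using (Star)

record SimpleGraph (V : Set) : Set₁ where
  field
    Adj    : V → V → Set
    symm   : ∀ {u v} → Adj u v → Adj v u
    irrefl : ∀ {v} → ¬ Adj v v
open SimpleGraph public

tensor : ∀ {V W} → SimpleGraph V → SimpleGraph W → SimpleGraph (V × W)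
tensor G H = record
  { Adj    = λ { (g , h) (g' , h') → Adj G g g' × Adj H h h' }
  ; symm   = λ { (a , b) → symm G a , symm H b }
  ; irrefl = λ { (a , _) → irrefl G a }
  }

complement : ∀ {V} → SimpleGraph V → SimpleGraph V
complement G = record
  { Adj    = λ u v → (u ≢ v) × (¬ Adj G u v)
  ; symm   = λ { (ne , na) → (λ e → ne (sym e)) , (λ a → na (symm G a)) }
  ; irrefl = λ { (ne , _) → ne _≡_.refl }
  }

Connected : ∀ {V} → SimpleGraph V → Set
Connected {V} G = ∀ (u v : V) → Star (Adj G) u v

Anticonnected : ∀ {V} → SimpleGraph V → Set
Anticonnected G = Connected (complement G)

{-# OPTIONS --safe #-}
module Submission where

-- Two vertices of G₁ × G₂ that agree in one coordinate are never adjacent, since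
-- that coordinate would have to be adjacent to itself.  So in the complement
-- (g , h) reaches (g , h') and then (g' , h') in at most one step each; finiteness
-- of the vertex sets is only needed for decidable equality.

open import Defs
open import Data.Nat using (ℕ)
open import Data.Fin using (Fin)
open import Data.Fin.Properties using (_≟_)
open import Data.Product using (_×_; _,_; proj₁; proj₂)
open import Relation.Nullary using (yes; no)
open import Relation.Binary.Definitions using (DecidableEquality)
open import Relation.Binary.PropositionalEquality using (_≢_; refl; cong)
open import Relation.Binary.Construct.Closure.ReflexiveTransitive
  using (Star; ε; _◅_; _◅◅_; gmap)

≢-walk : ∀ {A : Set} → DecidableEquality A → (x y : A) → Star _≢_ x y
≢-walk _≟A_ x y with x ≟A y
... | yes refl = ε
... | no x≢y   = x≢y ◅ ε

module _ {V W : Set} (G : SimpleGraph V) (H : SimpleGraph W) where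

  private
    Co : (V × W) → (V × W) → Set
    Co = Adj (complement (tensor G H))

  complement-tensor-sameˡ : ∀ g {h h'} → h ≢ h' → Co (g , h) (g , h')
  complement-tensor-sameˡ g h≢h' = (λ eq → h≢h' (cong proj₂ eq)) , (λ adj → irrefl G (proj₁ adj))

  complement-tensor-sameʳ : ∀ h {g g'} → g ≢ g' → Co (g , h) (g' , h)
  complement-tensor-sameʳ h g≢g' = (λ eq → g≢g' (cong proj₁ eq)) , (λ adj → irrefl H (proj₂ adj))

  tensor-anticonnected : DecidableEquality V → DecidableEquality W → Anticonnected (tensor G H)
  tensor-anticonnected _≟V_ _≟W_ (g , h) (g' , h') =
    gmap (g ,_) (complement-tensor-sameˡ g) (≢-walk _≟W_ h h')
      ◅◅ gmap (_, h') (complement-tensor-sameʳ h') (≢-walk _≟V_ g g')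

proposition5p2 : (n₁ n₂ : ℕ) (G₁ : SimpleGraph (Fin n₁)) (G₂ : SimpleGraph (Fin n₂)) → Anticonnected (tensor G₁ G₂)
proposition5p2 n₁ n₂ G₁ G₂ = tensor-anticonnected G₁ G₂ _≟_ _≟_
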